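{- Let $u$ be a finite nonempty factor of the Thue-Morse word $\mathbb{T}$. Then: (1) If $u$ is a prefix of $\mathbb{T}$, then $\mathbb{T}|_u$ is an IP-set. (2) If $u$ is a prefix of $\overline{\mathbb{T}}$, then $\mathbb{T}|_u$ is infinite FS-big but is not an IP-set. (3) If $u$ is neither a prefix of $\mathbb{T}$ nor a prefix of $\overline{\mathbb{T}}$, then $\mathbb{T}|_u$ is not $3$-summable. Moreover, $\mathbb{T}|_u$ is $2$-summable if and only if $u$ is a prefix of $\tau^n(010)$ or of $\tau^n(101)$ for some $n\geq 0$.
   Context: $\mathbb{N}$ denotes the set of positive integers. The Thue-Morse word is $\mathbb{T}=t_0t_1t_2\ldots\in\{0,1\}^\omega$, where $t_n$ is the sum modulo $2$ of the binary digits of $n$; equivalently, $\mathbb{T}$ is the fixed point beginning with $0$ of the morphism $\tau:0\mapsto 01,\ 1\mapsto 10$. $\overline{\mathbb{T}}$ is obtained from $\mathbb{T}$ by exchanging $0$'s and $1$'s (the fixed point of $\tau$ beginning with $1$). For a factor $u$ of $\mathbb{T}$, $\mathbb{T}|_u=\{n\in\mathbb{N}\,:\,t_nt_{n+1}\cdots t_{n+|u|-1}=u\}$, the set of occurrences of $u$ in $\mathbb{T}$. A sequence (finite or infinite) $\langle x_t\rangle$ in $\mathbb{N}$ satisfies uniqueness of finite sums if whenever $F,H$ are finite nonempty subsets of its index set with $\sum_{t\in F}x_t=\sum_{t\in H}x_t$, then $F=H$. A set $A\subseteq\mathbb{N}$ is $k$-summable if $A$ contains $\{\sum_{t\in F}x_t:\emptyset\neq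 F\subseteq\{1,\dots,k\}\}$ for some sequence $\langle x_t\rangle_{t=1}^k$ in $\mathbb{N}$ satisfying uniqueness of finite sums. $A$ is $k^\infty$-summable if there is an infinite sequence $\langle x_t\rangle_{t=1}^\infty$ in $\mathbb{N}$ satisfying uniqueness of finite sums such that $A$ contains $\{\sum_{t\in F}x_t:\emptyset\neq F\subseteq\mathbb{N},\ \#F\leq k\}$. $A$ is infinite FS-big if it is $k^\infty$-summable for every positive integer $k$. $A$ is an IP-set if there is an infinite sequence $\langle x_t\rangle_{t=1}^\infty$ in $\mathbb{N}$ with $\{\sum_{t\in F}x_t:F\text{ finite nonempty}\subseteq\mathbb{N}\}\subseteq A$. -}

module Defs where

open import Data.Bool using (Bool; true; false; not; _xor_)
open import Data.Nat using (ℕ; zero; suc; _+_; _≤_; _<_; _/_; _%_; _≟_)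
open import Data.List using (List; []; _∷_; _++_; map; length)
open import Data.Nat.ListAction using (sum)
open import Data.List.Relation.Unary.All using (All)
open import Data.List.Relation.Unary.Linked using (Linked)
open import Data.Product using (Σ; _×_; ∃)
open import Data.Unit using (⊤)
open import Relation.Binary.PropositionalEquality using (_≡_; _≢_)
open import Relation.Nullary using (yes; no)

-- Parity of the number of 1's in the binary expansion of n, with fuel
-- (fuel n suffices since n / 2 < n for n > 0).
parityBits : ℕ → ℕ → Bool
parityBits zero    n = false
parityBits (suc f) n with n ≟ 0
... | yes _ = false
... | no  _ with n % 2 ≟ 1
...   | yes _ = not (parityBits f (n / 2))
...   | no  _ = parityBits f (n / 2)

-- Thue–Morse word t_0 t_1 ... (0 = false, 1 = true)
T : ℕ → Bool
T n = parityBits n n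

Tbar : ℕ → Bool
Tbar n = not (T n)

Word : Set
Word = List Bool

OccursAt : (ℕ → Bool) → Word → ℕ → Set
OccursAt w []      n = ⊤
OccursAt w (b ∷ u) n = (w n ≡ b) × OccursAt w u (suc n)

IsFactor : (ℕ → Bool) → Word → Set
IsFactor w u = ∃ λ n → OccursAt w u n

IsPrefixOf : (ℕ → Bool) → Word → Set
IsPrefixOf w u = OccursAt w u 0

-- T|_u : occurrences at positive positions n ∈ ℕ = {1,2,...}
Occ : Word → ℕ → Set
Occ u n = (1 ≤ n) × OccursAt T u n

τ : Word → Word
τ []          = []
τ (false ∷ u) = false ∷ true ∷ τ u
τ (true ∷ u)  = true ∷ false ∷ τ u

τ^ : ℕ → Word → Word
τ^ zero    u = u
τ^ (suc n) u = τ (τ^ n u)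

IsListPrefix : Word → Word → Set
IsListPrefix u v = ∃ λ w → u ++ w ≡ v

-- Finite nonempty sets of indices, as strictly increasing nonempty lists
IsFinSet : List ℕ → Set
IsFinSet F = Linked _<_ F × (F ≢ [])

sumOver : (ℕ → ℕ) → List ℕ → ℕ
sumOver x F = sum (map x F)

UFS : (ℕ → Set) → (ℕ → ℕ) → Set
UFS I x = ∀ F H → IsFinSet F → IsFinSet H → All I F → All I H →
          sumOver x F ≡ sumOver x H → F ≡ H

-- k-summable (indices 0..k-1 stand for 1..k)
Summable : (ℕ → Set) → ℕ → Set
Summable A k = Σ (ℕ → ℕ) λ x →
  (∀ i → i < k → 1 ≤ x i) × UFS (λ i → i < k) x ×
  (∀ F → IsFinSet F → All (λ i → i < k) F → A (sumOver x F))

InfSummable : (ℕ → Set) → ℕ → Set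
InfSummable A k = Σ (ℕ → ℕ) λ x →
  (∀ i → 1 ≤ x i) × UFS (λ _ → ⊤) x ×
  (∀ F → IsFinSet F → length F ≤ k → A (sumOver x F))

InfFSBig : (ℕ → Set) → Set
InfFSBig A = ∀ k → 1 ≤ k → InfSummable A k

IPSet : (ℕ → Set) → Set
IPSet A = Σ (ℕ → ℕ) λ x →
  (∀ i → 1 ≤ x i) × (∀ F → IsFinSet F → A (sumOver x F))

-- T(n) is the parity of the binary digit sum of n, so T(a + 2^m q) = T(a) xor T(q) whenever a < 2^m.
--
-- (1) Sums of distinct numbers 3·4^i have an even digit sum; multiplied by 2^|u| they are positions
--     where T starts again with its own prefix u.
-- (2) For c = 2^m − 1 one has T(s·c) = T(c) for 1 ≤ s ≤ c, and T(c) = 1 for odd m. Taking m ≥ k odd,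
--     x_i = 2^|u|(c + 4^m·3·4^i) makes every sum of at most k terms a position where T starts with the
--     prefix u of T̄. No IP-set works: pigeonholing the parities of quotients, any sequence has finite
--     sums over indices ≥ 1 that are divisible by 2^(x_0), and adding x_0 to such a sum flips T.
-- (3) A square bb occurs only at odd positions, and x, y, x + y cannot all be odd. The words 010 and 101
--     occur only at positions ≡ 2, 3 (mod 4), which excludes three summands. A longer factor occurs at
--     positions of a single parity; 2-summability forces them to be even, and halving the sequence passes
--     to the desubstituted factor decode u, with u a prefix of τ (decode u). Conversely 010 occurs at
--     3, 15, 18 and 101 at 19, 79, 98, and τ^n doubles these positions.

module Submission where

open import Defs
open import Data.Bool using (Bool; true; false; not; _xor_)
open import Data.Bool.Properties using (not-¬; not-involutive; not-distribˡ-xor; not-distribʳ-xor; xor-comm; xor-identityʳ)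
open import Data.List using (List; []; _∷_; _++_; _∷ʳ_; map; length)
open import Data.List.Properties using (map-++; ++-assoc; ++-conicalˡ)
open import Data.List.Relation.Unary.All as All using (All; []; _∷_)
import Data.List.Relation.Unary.All.Properties as Allₚ
open import Data.List.Relation.Unary.AllPairs using (AllPairs; []; _∷_)
import Data.List.Relation.Unary.AllPairs.Properties as AllPairsₚ
open import Data.List.Relation.Unary.Linked using ([-]; _∷_)
open import Data.List.Relation.Unary.Linked.Properties using (Linked⇒AllPairs; AllPairs⇒Linked)
open import Data.Nat using (ℕ; zero; suc; _+_; _*_; _∸_; _^_; _≤_; _<_; _/_; _%_; _≟_; z≤n; s≤s; s≤s⁻¹)
open import Data.Nat.DivMod
open import Data.Nat.ListAction using (sum)
open import Data.Nat.ListAction.Properties using (sum-++)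
open import Data.Nat.Properties
open import Algebra.Properties.CommutativeSemigroup *-commutativeSemigroup using (x∙yz≈y∙xz)
open import Data.Nat.Tactic.RingSolver using (solve-∀)
open import Data.Product using (_×_; _,_; proj₁; proj₂; ∃)
open import Data.Sum using (_⊎_; inj₁; inj₂)
open import Data.Unit using (tt)
open import Function using (_∘_)
open import Function.Bundles using (_⇔_; mk⇔)
open import Relation.Binary.PropositionalEquality
open import Relation.Nullary using (yes; no; ¬_)
open import Relation.Nullary.Negation using (contradiction)

data Parity : ℕ → Set where
  even : ∀ p → Parity (2 * p)
  odd  : ∀ p → Parity (suc (2 * p))

2[1+p]≡2+2p : ∀ p → 2 * suc p ≡ suc (suc (2 * p))
2[1+p]≡2+2p = solve-∀

parity : ∀ n → Parity n
parity zero = even 0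
parity (suc n) with parity n
... | even p = odd p
... | odd p  = subst Parity (2[1+p]≡2+2p p) (even (suc p))

2p+2q≡2[p+q] : ∀ p q → 2 * p + 2 * q ≡ 2 * (p + q)
2p+2q≡2[p+q] p q = sym (*-distribˡ-+ 2 p q)

[1+2p]+[1+2q]≡2[1+p+q] : ∀ p q → suc (2 * p) + suc (2 * q) ≡ 2 * suc (p + q)
[1+2p]+[1+2q]≡2[1+p+q] = solve-∀

2a+2b≡2c⇒a+b≡c : ∀ a b c → 2 * a + 2 * b ≡ 2 * c → a + b ≡ c
2a+2b≡2c⇒a+b≡c a b c e = *-cancelˡ-≡ (a + b) c 2 (trans (*-distribˡ-+ 2 a b) e)

Even Odd : ℕ → Set
Even n = ∃ λ p → n ≡ 2 * p
Odd  n = ∃ λ p → n ≡ suc (2 * p)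

even⊎odd : ∀ n → Even n ⊎ Odd n
even⊎odd n with parity n
... | even p = inj₁ (p , refl)
... | odd p  = inj₂ (p , refl)

odd+odd≢odd : ∀ {a b} → Odd a → Odd b → ¬ Odd (a + b)
odd+odd≢odd (p , refl) (q , refl) (r , a+b≡) = even≢odd (suc (p + q)) r (trans (sym ([1+2p]+[1+2q]≡2[1+p+q] p q)) a+b≡)

odd⇒suc-¬odd : ∀ {p} → Odd p → ¬ Odd (suc p)
odd⇒suc-¬odd (a , refl) (b , 2+2a≡1+2b) = even≢odd (suc a) b (trans (2[1+p]≡2+2p a) 2+2a≡1+2b)

[1+m]/2≤m : ∀ m → suc m / 2 ≤ m
[1+m]/2≤m m = s≤s⁻¹ (m/n<m (suc m) 2 (s≤s (s≤s z≤n)))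

parityBits-fuel : ∀ f g n → n ≤ f → n ≤ g → parityBits f n ≡ parityBits g n
parityBits-fuel zero    zero    zero _ _ = refl
parityBits-fuel zero    (suc g) zero _ _ = refl
parityBits-fuel (suc f) zero    zero _ _ = refl
parityBits-fuel (suc f) (suc g) zero _ _ = refl
parityBits-fuel (suc f) (suc g) (suc m) (s≤s m≤f) (s≤s m≤g) with suc m % 2 ≟ 1
... | yes _ = cong not (parityBits-fuel f g (suc m / 2) (≤-trans ([1+m]/2≤m m) m≤f) (≤-trans ([1+m]/2≤m m) m≤g))
... | no _  = parityBits-fuel f g (suc m / 2) (≤-trans ([1+m]/2≤m m) m≤f) (≤-trans ([1+m]/2≤m m) m≤g)

T-unfold : ∀ m → parityBits m (suc m / 2) ≡ T (suc m / 2)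
T-unfold m = parityBits-fuel m (suc m / 2) (suc m / 2) ([1+m]/2≤m m) ≤-refl

T-suc-even : ∀ m → suc m % 2 ≡ 0 → T (suc m) ≡ T (suc m / 2)
T-suc-even m r with suc m % 2 ≟ 1
... | yes r′ = contradiction (trans (sym r) r′) 0≢1+n
... | no _   = T-unfold m

T-suc-odd : ∀ m → suc m % 2 ≡ 1 → T (suc m) ≡ not (T (suc m / 2))
T-suc-odd m r with suc m % 2 ≟ 1
... | yes _ = cong not (T-unfold m)
... | no r′ = contradiction r r′

2p%2≡0 : ∀ p → 2 * p % 2 ≡ 0
2p%2≡0 p = trans (cong (_% 2) (*-comm 2 p)) (m*n%n≡0 p 2)

2p/2≡p : ∀ p → 2 * p / 2 ≡ p
2p/2≡p p = trans (cong (_/ 2) (*-comm 2 p)) (m*n/n≡m p 2)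

[1+2p]%2≡1 : ∀ p → suc (2 * p) % 2 ≡ 1
[1+2p]%2≡1 p = trans (cong (λ n → suc n % 2) (*-comm 2 p)) ([m+kn]%n≡m%n 1 p 2)

[1+2p]/2≡p : ∀ p → suc (2 * p) / 2 ≡ p
[1+2p]/2≡p p = trans (cong (λ n → suc n / 2) (*-comm 2 p))
  (trans (+-distrib-/ 1 (p * 2) (subst (λ r → 1 + r < 2) (sym (m*n%n≡0 p 2)) ≤-refl)) (m*n/n≡m p 2))

T-double : ∀ p → T (2 * p) ≡ T p
T-double zero    = refl
T-double (suc p) = trans (T-suc-even (p + 1 * suc p) (2p%2≡0 (suc p))) (cong T (2p/2≡p (suc p)))

T-double+1 : ∀ p → T (suc (2 * p)) ≡ not (T p)
T-double+1 p = trans (T-suc-odd (2 * p) ([1+2p]%2≡1 p)) (cong (not ∘ T) ([1+2p]/2≡p p))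

T-double+2 : ∀ p → T (suc (suc (2 * p))) ≡ T (suc p)
T-double+2 p = trans (cong T (sym (2[1+p]≡2+2p p))) (T-double (suc p))

T-double+3 : ∀ p → T (suc (suc (suc (2 * p)))) ≡ not (T (suc p))
T-double+3 p = trans (cong (T ∘ suc) (sym (2[1+p]≡2+2p p))) (T-double+1 (suc p))

T-double+4 : ∀ p → T (suc (suc (suc (suc (2 * p))))) ≡ T (suc (suc p))
T-double+4 p = trans (cong (T ∘ suc ∘ suc) (sym (2[1+p]≡2+2p p))) (T-double+2 (suc p))

T-equal-neighbours⇒odd : ∀ p → T p ≡ T (suc p) → Odd p
T-equal-neighbours⇒odd p Tp≡T[1+p] with parity p
... | even q = contradiction (trans (sym (T-double q)) (trans Tp≡T[1+p] (T-double+1 q))) (not-¬ refl)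
... | odd q  = q , refl

T-cube-free : ∀ p → T p ≡ T (suc p) → T (suc p) ≢ T (suc (suc p))
T-cube-free p e₀ e₁ = odd⇒suc-¬odd (T-equal-neighbours⇒odd p e₀) (T-equal-neighbours⇒odd (suc p) e₁)

2a+2^[1+m]q≡2[a+2^mq] : ∀ m a q → 2 * a + 2 ^ suc m * q ≡ 2 * (a + 2 ^ m * q)
2a+2^[1+m]q≡2[a+2^mq] m a q = trans (cong (2 * a +_) (*-assoc 2 (2 ^ m) q)) (sym (*-distribˡ-+ 2 a _))

T-split : ∀ m a q → a < 2 ^ m → T (a + 2 ^ m * q) ≡ T a xor T q
T-split zero    zero    q _         = cong T (+-identityʳ q)
T-split zero    (suc a) q (s≤s ())
T-split (suc m) a       q a<2^[1+m] with parity a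
... | even p = begin
  T (2 * p + 2 ^ suc m * q)   ≡⟨ cong T (2a+2^[1+m]q≡2[a+2^mq] m p q) ⟩
  T (2 * (p + 2 ^ m * q))     ≡⟨ T-double (p + 2 ^ m * q) ⟩
  T (p + 2 ^ m * q)           ≡⟨ T-split m p q (*-cancelˡ-< 2 p (2 ^ m) a<2^[1+m]) ⟩
  T p xor T q                 ≡⟨ cong (_xor T q) (sym (T-double p)) ⟩
  T (2 * p) xor T q           ∎
  where open ≡-Reasoning
... | odd p = begin
  T (suc (2 * p + 2 ^ suc m * q))   ≡⟨ cong (T ∘ suc) (2a+2^[1+m]q≡2[a+2^mq] m p q) ⟩
  T (suc (2 * (p + 2 ^ m * q)))     ≡⟨ T-double+1 (p + 2 ^ m * q) ⟩
  not (T (p + 2 ^ m * q))           ≡⟨ cong not (T-split m p q (*-cancelˡ-< 2 p (2 ^ m) (<⇒≤ a<2^[1+m]))) ⟩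
  not (T p xor T q)                 ≡⟨ not-distribˡ-xor (T p) (T q) ⟩
  not (T p) xor T q                 ≡⟨ cong (_xor T q) (sym (T-double+1 p)) ⟩
  T (suc (2 * p)) xor T q           ∎
  where open ≡-Reasoning

n<2^n : ∀ n → n < 2 ^ n
n<2^n zero    = s≤s z≤n
n<2^n (suc n) = +-mono-≤ (m^n>0 2 n) (≤-trans (n<2^n n) (m≤m+n (2 ^ n) 0))

4^m≡2^[2m] : ∀ m → 4 ^ m ≡ 2 ^ (2 * m)
4^m≡2^[2m] = ^-*-assoc 2 2

T-split₄ : ∀ m a q → a < 4 ^ m → T (a + 4 ^ m * q) ≡ T a xor T q
T-split₄ m a q a<4^m rewrite 4^m≡2^[2m] m = T-split (2 * m) a q a<4^m

T-4^* : ∀ m q → T (4 ^ m * q) ≡ T q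
T-4^* m q = T-split₄ m 0 q (m^n>0 4 m)

*-pos : ∀ {a b} → 1 ≤ a → 1 ≤ b → 1 ≤ a * b
*-pos = *-mono-≤

Increasing : List ℕ → Set
Increasing = AllPairs _<_

sumOver-* : ∀ c y F → sumOver (λ i → c * y i) F ≡ c * sumOver y F
sumOver-* c y []      = sym (*-zeroʳ c)
sumOver-* c y (i ∷ F) = trans (cong (c * y i +_) (sumOver-* c y F)) (sym (*-distribˡ-+ c (y i) _))

sumOver-++ : ∀ x F G → sumOver x (F ++ G) ≡ sumOver x F + sumOver x G
sumOver-++ x F G = trans (cong sum (map-++ x F G)) (sum-++ (map x F) (map x G))

sumOver-affine : ∀ c D y F → sumOver (λ i → c + D * y i) F ≡ length F * c + D * sumOver y F
sumOver-affine c D y []      = sym (*-zeroʳ D)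
sumOver-affine c D y (i ∷ F) =
  trans (cong ((c + D * y i) +_) (sumOver-affine c D y F)) (regroup c D (y i) (length F) (sumOver y F))
  where regroup : ∀ c D a s Y → (c + D * a) + (s * c + D * Y) ≡ (c + s * c) + D * (a + Y)
        regroup = solve-∀

sumOver-pos : ∀ y F → (∀ i → 1 ≤ y i) → F ≢ [] → 1 ≤ sumOver y F
sumOver-pos y []      _    F≢[] = contradiction refl F≢[]
sumOver-pos y (i ∷ F) y≥1 _    = ≤-trans (y≥1 i) (m≤m+n _ _)

length-pos : ∀ {F : List ℕ} → F ≢ [] → 1 ≤ length F
length-pos {[]}    F≢[] = contradiction refl F≢[]
length-pos {_ ∷ _} _    = s≤s z≤n

Increasing-++ : ∀ {F G t} → Increasing F → Increasing G → All (_< t) F → All (t ≤_) G → Increasing (F ++ G)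
Increasing-++ incF incG F<t t≤G =
  AllPairsₚ.++⁺ incF incG (All.map (λ i<t → All.map (<-≤-trans i<t) t≤G) F<t)

sumOver-∷ʳ : ∀ x F n → sumOver x (F ∷ʳ n) ≡ sumOver x F + x n
sumOver-∷ʳ x F n = begin
  sum (map x (F ++ n ∷ []))     ≡⟨ cong sum (map-++ x F (n ∷ [])) ⟩
  sum (map x F ++ x n ∷ [])     ≡⟨ sum-++ (map x F) (x n ∷ []) ⟩
  sumOver x F + (x n + 0)       ≡⟨ cong (sumOver x F +_) (+-identityʳ (x n)) ⟩
  sumOver x F + x n             ∎
  where open ≡-Reasoning

data BelowSuc (n : ℕ) : List ℕ → Set where
  below  : ∀ {F} → All (_< n) F → BelowSuc n F
  ending : ∀ {F} → Increasing F → All (_< n) F → BelowSuc n (F ∷ʳ n)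

belowSuc : ∀ {n F} → Increasing F → All (_< suc n) F → BelowSuc n F
belowSuc                 []            []          = below []
belowSuc {n} {i ∷ F} (i<F ∷ incF) (i≤n ∷ F≤n) with belowSuc incF F≤n
... | ending {F₀} incF₀ F₀<n with Allₚ.++⁻ F₀ i<F
...   | i<F₀ , i<n ∷ [] = ending (i<F₀ ∷ incF₀) (i<n ∷ F₀<n)
belowSuc {n} {i ∷ F} (i<F ∷ incF) (i≤n ∷ F≤n) | below F<n with i <? n
... | yes i<n = below (i<n ∷ F<n)
... | no  i≮n with F | i<F | F<n
...   | []    | _         | _         = subst (BelowSuc n) (cong (_∷ []) (≤-antisym n≤i (s≤s⁻¹ i≤n))) (ending [] [])
  where n≤i = ≮⇒≥ i≮n
...   | j ∷ _ | i<j ∷ _   | j<n ∷ _   = contradiction (<-trans i<j j<n) i≮n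

partialSum : (ℕ → ℕ) → ℕ → ℕ
partialSum x zero    = 0
partialSum x (suc n) = partialSum x n + x n

sumOver≤partialSum : ∀ x n {F} → Increasing F → All (_< n) F → sumOver x F ≤ partialSum x n
sumOver≤partialSum x zero    []  []           = z≤n
sumOver≤partialSum x zero    _   (() ∷ _)
sumOver≤partialSum x (suc n) incF F<1+n with belowSuc incF F<1+n
... | below F<n = ≤-trans (sumOver≤partialSum x n incF F<n) (m≤m+n _ _)
... | ending {F₀} incF₀ F₀<n = begin
  sumOver x (F₀ ∷ʳ n)   ≡⟨ sumOver-∷ʳ x F₀ n ⟩
  sumOver x F₀ + x n    ≤⟨ +-monoˡ-≤ (x n) (sumOver≤partialSum x n incF₀ F₀<n) ⟩
  partialSum x n + x n  ∎
  where open ≤-Reasoning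

All-≤-sum : ∀ F → All (_≤ sum F) F
All-≤-sum []      = []
All-≤-sum (i ∷ F) = m≤m+n i (sum F) ∷ All.map (λ j≤ΣF → ≤-trans j≤ΣF (m≤n+m (sum F) i)) (All-≤-sum F)

Superincreasing : (ℕ → ℕ) → Set
Superincreasing x = ∀ n → partialSum x n < x n

module _ {x : ℕ → ℕ} (sup : Superincreasing x) where

  sumOver<sumOver-ending : ∀ {n F H} → Increasing H → All (_< n) H → sumOver x H < sumOver x (F ∷ʳ n)
  sumOver<sumOver-ending {n} {F} {H} incH H<n = begin-strict
    sumOver x H         ≤⟨ sumOver≤partialSum x n incH H<n ⟩
    partialSum x n      <⟨ sup n ⟩
    x n                 ≤⟨ m≤n+m (x n) (sumOver x F) ⟩
    sumOver x F + x n   ≡⟨ sumOver-∷ʳ x F n ⟨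
    sumOver x (F ∷ʳ n)  ∎
    where open ≤-Reasoning

  sumOver-injective-below : ∀ n {F H} → Increasing F → Increasing H → All (_< n) F → All (_< n) H →
                            sumOver x F ≡ sumOver x H → F ≡ H
  sumOver-injective-below zero    _ _ []       []       _ = refl
  sumOver-injective-below zero    _ _ (() ∷ _) _        _
  sumOver-injective-below zero    _ _ []       (() ∷ _) _
  sumOver-injective-below (suc n) incF incH F<1+n H<1+n eq with belowSuc incF F<1+n | belowSuc incH H<1+n
  ... | below F<n | below H<n = sumOver-injective-below n incF incH F<n H<n eq
  ... | ending {F₀} _ _ | below H<n = contradiction (sym eq) (<⇒≢ (sumOver<sumOver-ending {F = F₀} incH H<n))
  ... | below F<n | ending {H₀} _ _ = contradiction eq (<⇒≢ (sumOver<sumOver-ending {F = H₀} incF F<n))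
  ... | ending {F₀} incF₀ F₀<n | ending {H₀} incH₀ H₀<n = cong (_∷ʳ n)
    (sumOver-injective-below n incF₀ incH₀ F₀<n H₀<n (+-cancelʳ-≡ _ _ _ (begin
      sumOver x F₀ + x n  ≡⟨ sumOver-∷ʳ x F₀ n ⟨
      sumOver x (F₀ ∷ʳ n) ≡⟨ eq ⟩
      sumOver x (H₀ ∷ʳ n) ≡⟨ sumOver-∷ʳ x H₀ n ⟩
      sumOver x H₀ + x n  ∎)))
    where open ≡-Reasoning

  superincreasing⇒UFS : ∀ {I} → UFS I x
  superincreasing⇒UFS F H (linkedF , _) (linkedH , _) _ _ =
    sumOver-injective-below (suc (sum F + sum H)) (Linked⇒AllPairs <-trans linkedF) (Linked⇒AllPairs <-trans linkedH)
      (All.map (λ i≤ΣF → s≤s (≤-trans i≤ΣF (m≤m+n _ _))) (All-≤-sum F))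
      (All.map (λ i≤ΣH → s≤s (≤-trans i≤ΣH (m≤n+m _ _))) (All-≤-sum H))

doubling⇒superincreasing : ∀ {x} → 1 ≤ x 0 → (∀ n → 2 * x n ≤ x (suc n)) → Superincreasing x
doubling⇒superincreasing x₀≥1 dbl zero    = x₀≥1
doubling⇒superincreasing {x} x₀≥1 dbl (suc n) = begin-strict
  partialSum x n + x n  <⟨ +-monoˡ-< (x n) (doubling⇒superincreasing x₀≥1 dbl n) ⟩
  x n + x n             ≡⟨ cong (x n +_) (+-identityʳ (x n)) ⟨
  2 * x n               ≤⟨ dbl n ⟩
  x (suc n)             ∎
  where open ≤-Reasoning

OccursAt-transport : ∀ {w w′ : ℕ → Bool} u {n m} → (∀ j → j < length u → w (n + j) ≡ w′ (m + j)) →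
                     OccursAt w′ u m → OccursAt w u n
OccursAt-transport         []      _     _           = tt
OccursAt-transport {w} {w′} (b ∷ u) {n} {m} agree (w′m≡b , rest) =
  trans (trans (cong w (sym (+-identityʳ n))) (trans (agree 0 (s≤s z≤n)) (cong w′ (+-identityʳ m)))) w′m≡b ,
  OccursAt-transport u (λ j j<|u| → trans (cong w (sym (+-suc n j)))
                                     (trans (agree (suc j) (s≤s j<|u|)) (cong w′ (+-suc m j)))) rest

OccursAt-prefix : ∀ {w : ℕ → Bool} {u v n} → IsListPrefix u v → OccursAt w v n → OccursAt w u n
OccursAt-prefix {u = []}    _               _            = tt
OccursAt-prefix {u = b ∷ u} (z , refl) (wn≡b , rest) = wn≡b , OccursAt-prefix (z , refl) rest

IsListPrefix-trans : ∀ {u v w} → IsListPrefix u v → IsListPrefix v w → IsListPrefix u w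
IsListPrefix-trans {u} (a , refl) (b , refl) = a ++ b , sym (++-assoc u a b)

τ-++ : ∀ u v → τ (u ++ v) ≡ τ u ++ τ v
τ-++ []          v = refl
τ-++ (false ∷ u) v = cong (λ w → false ∷ true ∷ w) (τ-++ u v)
τ-++ (true ∷ u)  v = cong (λ w → true ∷ false ∷ w) (τ-++ u v)

IsListPrefix-τ : ∀ {u v} → IsListPrefix u v → IsListPrefix (τ u) (τ v)
IsListPrefix-τ {u} (z , refl) = τ z , sym (τ-++ u z)

τ-∷ : ∀ b u → τ (b ∷ u) ≡ b ∷ not b ∷ τ u
τ-∷ false u = refl
τ-∷ true  u = refl

module _ {w : ℕ → Bool} (w-double : ∀ q → w (2 * q) ≡ w q) (w-double+1 : ∀ q → w (suc (2 * q)) ≡ not (w q)) where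

  OccursAt-τ : ∀ u q → OccursAt w u q → OccursAt w (τ u) (2 * q)
  OccursAt-τ []      q _             = tt
  OccursAt-τ (b ∷ u) q (wq≡b , rest) rewrite τ-∷ b u =
    trans (w-double q) wq≡b , trans (w-double+1 q) (cong not wq≡b) ,
    subst (OccursAt w (τ u)) (2[1+p]≡2+2p q) (OccursAt-τ u (suc q) rest)

OccursAt-T-τ : ∀ u q → OccursAt T u q → OccursAt T (τ u) (2 * q)
OccursAt-T-τ = OccursAt-τ T-double T-double+1

OccursAt-Tbar-τ : ∀ u q → OccursAt Tbar u q → OccursAt Tbar (τ u) (2 * q)
OccursAt-Tbar-τ = OccursAt-τ (cong not ∘ T-double) (cong not ∘ T-double+1)

OccursAt-T-τ^ : ∀ n u q → OccursAt T u q → OccursAt T (τ^ n u) (2 ^ n * q)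
OccursAt-T-τ^ zero    u q occ = subst (OccursAt T u) (sym (*-identityˡ q)) occ
OccursAt-T-τ^ (suc n) u q occ =
  subst (OccursAt T (τ^ (suc n) u)) (sym (*-assoc 2 (2 ^ n) q)) (OccursAt-T-τ (τ^ n u) (2 ^ n * q) (OccursAt-T-τ^ n u q occ))

decode : Word → Word
decode []          = []
decode (a ∷ [])    = a ∷ []
decode (a ∷ _ ∷ u) = a ∷ decode u

decode-length : ∀ u → length (decode u) ≤ length u
decode-length []          = z≤n
decode-length (a ∷ [])    = ≤-refl
decode-length (a ∷ _ ∷ u) = s≤s (m≤n⇒m≤1+n (decode-length u))

OccursAt-decode : ∀ u p → OccursAt T u (2 * p) → OccursAt T (decode u) p
OccursAt-decode []          p _                     = tt
OccursAt-decode (a ∷ [])    p (T2p≡a , _)           = trans (sym (T-double p)) T2p≡a , tt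
OccursAt-decode (a ∷ _ ∷ u) p (T2p≡a , _ , rest) =
  trans (sym (T-double p)) T2p≡a , OccursAt-decode u (suc p) (subst (OccursAt T u) (sym (2[1+p]≡2+2p p)) rest)

IsListPrefix-τ-decode : ∀ u p → OccursAt T u (2 * p) → IsListPrefix u (τ (decode u))
IsListPrefix-τ-decode []          p _           = [] , refl
IsListPrefix-τ-decode (a ∷ [])    p _           = not a ∷ [] , sym (τ-∷ a [])
IsListPrefix-τ-decode (a ∷ b ∷ u) p (T2p≡a , T[2p+1]≡b , rest)
  with z , u++z≡τdu ← IsListPrefix-τ-decode u (suc p) (subst (OccursAt T u) (sym (2[1+p]≡2+2p p)) rest) =
  z , (begin
    a ∷ b ∷ u ++ z         ≡⟨ cong (λ c → a ∷ c ∷ u ++ z) b≡not-a ⟩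
    a ∷ not a ∷ u ++ z     ≡⟨ cong (λ v → a ∷ not a ∷ v) u++z≡τdu ⟩
    a ∷ not a ∷ τ (decode u) ≡⟨ τ-∷ a (decode u) ⟨
    τ (a ∷ decode u)       ∎)
  where open ≡-Reasoning
        b≡not-a : b ≡ not a
        b≡not-a = trans (sym T[2p+1]≡b) (trans (T-double+1 p) (cong not (trans (sym (T-double p)) T2p≡a)))

IsPrefixOf-T-decode⇒IsPrefixOf-T : ∀ u p → OccursAt T u (2 * p) → IsPrefixOf T (decode u) → IsPrefixOf T u
IsPrefixOf-T-decode⇒IsPrefixOf-T u p occ pre =
  OccursAt-prefix (IsListPrefix-τ-decode u p occ) (OccursAt-T-τ (decode u) 0 pre)

IsPrefixOf-Tbar-decode⇒IsPrefixOf-Tbar : ∀ u p → OccursAt T u (2 * p) → IsPrefixOf Tbar (decode u) → IsPrefixOf Tbar u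
IsPrefixOf-Tbar-decode⇒IsPrefixOf-Tbar u p occ pre =
  OccursAt-prefix (IsListPrefix-τ-decode u p occ) (OccursAt-Tbar-τ (decode u) 0 pre)

module Summands {A : ℕ → Set} {k : ℕ} (S : Summable A k) where
  x : ℕ → ℕ
  x = proj₁ S

  private
    sums : ∀ F → IsFinSet F → All (_< k) F → A (sumOver x F)
    sums = proj₂ (proj₂ (proj₂ S))

  summand₁ : ∀ {i} → i < k → A (x i)
  summand₁ {i} i<k = subst A (+-identityʳ (x i)) (sums (i ∷ []) ([-] , λ ()) (i<k ∷ []))

  summand₂ : ∀ {i j} → i < j → j < k → A (x i + x j)
  summand₂ {i} {j} i<j j<k = subst A (cong (x i +_) (+-identityʳ (x j)))
    (sums (i ∷ j ∷ []) (i<j ∷ [-] , λ ()) (<-trans i<j j<k ∷ j<k ∷ []))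

  summand₃ : ∀ {i j l} → i < j → j < l → l < k → A (x i + (x j + x l))
  summand₃ {i} {j} {l} i<j j<l l<k = subst A (cong (λ n → x i + (x j + n)) (+-identityʳ (x l)))
    (sums (i ∷ j ∷ l ∷ []) (i<j ∷ j<l ∷ [-] , λ ()) (<-trans i<j (<-trans j<l l<k) ∷ <-trans j<l l<k ∷ l<k ∷ []))

0<1 : 0 < 1
0<1 = s≤s z≤n

1<2 : 1 < 2
1<2 = s≤s 0<1

2<3 : 2 < 3
2<3 = s≤s 1<2

odd⇒¬2-summable : ∀ {A k} → 2 ≤ k → (∀ {n} → A n → Odd n) → ¬ Summable A k
odd⇒¬2-summable {A} 2≤k isOdd S =
  odd+odd≢odd (isOdd (summand₁ (<-trans 0<1 2≤k))) (isOdd (summand₁ 2≤k)) (isOdd (summand₂ 0<1 2≤k))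
  where open Summands {A} S

Summable-halve : ∀ {A B : ℕ → Set} {k} → (∀ {n} → A n → Even n) → (∀ p → A (2 * p) → B p) →
                 Summable A k → Summable B k
Summable-halve {A} {B} {k} isEven halve S@(x , x-pos , ufs , sums) = x′ , x′-pos , ufs′ , sums′
  where
  open Summands {A} S using (summand₁)
  x′ : ℕ → ℕ
  x′ i = x i / 2
  x≡2x′ : ∀ {i} → i < k → x i ≡ 2 * x′ i
  x≡2x′ i<k with p , xi≡2p ← isEven (summand₁ i<k) =
    trans xi≡2p (cong (2 *_) (sym (trans (cong (_/ 2) xi≡2p) (2p/2≡p p))))
  sumOver-x≡2sumOver-x′ : ∀ {F} → All (_< k) F → sumOver x F ≡ 2 * sumOver x′ F
  sumOver-x≡2sumOver-x′ []           = refl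
  sumOver-x≡2sumOver-x′ {i ∷ F} (i<k ∷ F<k) =
    trans (cong₂ _+_ (x≡2x′ i<k) (sumOver-x≡2sumOver-x′ F<k)) (2p+2q≡2[p+q] (x′ i) (sumOver x′ F))
  pos-half : ∀ {a} → 1 ≤ 2 * a → 1 ≤ a
  pos-half {suc a} _ = s≤s z≤n
  x′-pos : ∀ i → i < k → 1 ≤ x′ i
  x′-pos i i<k = pos-half (subst (1 ≤_) (x≡2x′ i<k) (x-pos i i<k))
  ufs′ : UFS (_< k) x′
  ufs′ F H finF finH F<k H<k ΣF≡ΣH =
    ufs F H finF finH F<k H<k
      (trans (sumOver-x≡2sumOver-x′ F<k) (trans (cong (2 *_) ΣF≡ΣH) (sym (sumOver-x≡2sumOver-x′ H<k))))
  sums′ : ∀ F → IsFinSet F → All (_< k) F → B (sumOver x′ F)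
  sums′ F finF F<k = halve (sumOver x′ F) (subst A (sumOver-x≡2sumOver-x′ F<k) (sums F finF F<k))

Residue₂₃ : ℕ → Set
Residue₂₃ n = n % 4 ≡ 2 ⊎ n % 4 ≡ 3

Residue₂₃-+ : ∀ m n → Residue₂₃ m → Residue₂₃ n → Residue₂₃ (m + n) → m % 4 ≡ 3 × n % 4 ≡ 3
Residue₂₃-+ m n rm rn rmn = by-cases rm rn (subst (λ r → r ≡ 2 ⊎ r ≡ 3) (%-distribˡ-+ m n 4) rmn)
  where
  by-cases : ∀ {a b} → (a ≡ 2 ⊎ a ≡ 3) → (b ≡ 2 ⊎ b ≡ 3) → ((a + b) % 4 ≡ 2 ⊎ (a + b) % 4 ≡ 3) →
             a ≡ 3 × b ≡ 3
  by-cases (inj₂ refl) (inj₂ refl) _        = refl , refl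
  by-cases (inj₁ refl) (inj₁ refl) (inj₁ ())
  by-cases (inj₁ refl) (inj₁ refl) (inj₂ ())
  by-cases (inj₁ refl) (inj₂ refl) (inj₁ ())
  by-cases (inj₁ refl) (inj₂ refl) (inj₂ ())
  by-cases (inj₂ refl) (inj₁ refl) (inj₁ ())
  by-cases (inj₂ refl) (inj₁ refl) (inj₂ ())

Residue₂₃⇒¬3-summable : ∀ {A} → (∀ {n} → A n → Residue₂₃ n) → ¬ Summable A 3
Residue₂₃⇒¬3-summable {A} residue S = ¬Residue₂₃ (residue (summand₃ 0<1 1<2 2<3))
  where
  open Summands {A} S
  0<3 : 0 < 3
  0<3 = <-trans 0<1 (<-trans 1<2 2<3)
  1<3 : 1 < 3
  1<3 = <-trans 1<2 2<3
  x₀≡₄3 : x 0 % 4 ≡ 3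
  x₀≡₄3 = proj₁ (Residue₂₃-+ (x 0) (x 1)
    (residue (summand₁ 0<3)) (residue (summand₁ 1<3)) (residue (summand₂ 0<1 1<3)))
  x₁₂≡₄3 : x 1 % 4 ≡ 3 × x 2 % 4 ≡ 3
  x₁₂≡₄3 = Residue₂₃-+ (x 1) (x 2)
    (residue (summand₁ 1<3)) (residue (summand₁ 2<3)) (residue (summand₂ 1<2 2<3))
  x₁+x₂≡₄2 : (x 1 + x 2) % 4 ≡ 2
  x₁+x₂≡₄2 =
    trans (%-distribˡ-+ (x 1) (x 2) 4) (cong₂ (λ a b → (a + b) % 4) (proj₁ x₁₂≡₄3) (proj₂ x₁₂≡₄3))
  x₀+x₁+x₂≡₄1 : (x 0 + (x 1 + x 2)) % 4 ≡ 1
  x₀+x₁+x₂≡₄1 =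
    trans (%-distribˡ-+ (x 0) (x 1 + x 2) 4) (cong₂ (λ a b → (a + b) % 4) x₀≡₄3 x₁+x₂≡₄2)
  ¬Residue₂₃ : ¬ Residue₂₃ (x 0 + (x 1 + x 2))
  ¬Residue₂₃ (inj₁ ≡2) = contradiction (trans (sym x₀+x₁+x₂≡₄1) ≡2) λ ()
  ¬Residue₂₃ (inj₂ ≡3) = contradiction (trans (sym x₀+x₁+x₂≡₄1) ≡3) λ ()

finSet-below-2 : ∀ {F} → IsFinSet F → All (_< 2) F → F ≡ 0 ∷ [] ⊎ F ≡ 1 ∷ [] ⊎ F ≡ 0 ∷ 1 ∷ []
finSet-below-2 {[]}                 (_ , F≢[])          _                      = contradiction refl F≢[]
finSet-below-2 {0 ∷ []}             _                   _                      = inj₁ refl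
finSet-below-2 {1 ∷ []}             _                   _                      = inj₂ (inj₁ refl)
finSet-below-2 {0 ∷ 1 ∷ []}         _                   _                      = inj₂ (inj₂ refl)
finSet-below-2 {0 ∷ 0 ∷ _}          (() ∷ _ , _)        _
finSet-below-2 {0 ∷ 1 ∷ _ ∷ _}      (_ ∷ 1<j ∷ _ , _)   (_ ∷ _ ∷ j<2 ∷ _)      = contradiction 1<j (<⇒≱ j<2)
finSet-below-2 {1 ∷ _ ∷ _}          (1<j ∷ _ , _)       (_ ∷ j<2 ∷ _)          = contradiction 1<j (<⇒≱ j<2)
finSet-below-2 {0 ∷ suc (suc _) ∷ _} _                  (_ ∷ s≤s (s≤s ()) ∷ _)
finSet-below-2 {suc (suc _) ∷ _}    _                   (s≤s (s≤s ()) ∷ _)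

2-summable : ∀ {A : ℕ → Set} {a b} → 1 ≤ a → 2 * a ≤ b → A a → A b → A (a + b) → Summable A 2
2-summable {A} {a} {b} a≥1 2a≤b Aa Ab Aa+b =
  x , x-pos , superincreasing⇒UFS (doubling⇒superincreasing {x} a≥1 x-doubling) , sums
  where
  x : ℕ → ℕ
  x zero                = a
  x (suc zero)          = b
  x (suc (suc i))       = 2 * x (suc i)
  x-doubling : ∀ i → 2 * x i ≤ x (suc i)
  x-doubling zero    = 2a≤b
  x-doubling (suc i) = ≤-refl
  x-pos : ∀ i → i < 2 → 1 ≤ x i
  x-pos zero       _ = a≥1
  x-pos (suc zero) _ = ≤-trans a≥1 (≤-trans (m≤m+n a (a + 0)) 2a≤b)
  x-pos (suc (suc i)) (s≤s (s≤s ()))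
  sums : ∀ F → IsFinSet F → All (_< 2) F → A (sumOver x F)
  sums F finF F<2 with finSet-below-2 finF F<2
  ... | inj₁ refl        = subst A (sym (+-identityʳ a)) Aa
  ... | inj₂ (inj₁ refl) = subst A (sym (+-identityʳ b)) Ab
  ... | inj₂ (inj₂ refl) = subst A (cong (a +_) (sym (+-identityʳ b))) Aa+b

-- Prefixes of T

-- In binary, 3 · 4 ^ i is the digit block 11 at positions 2i and 2i+1.
pairBit : ℕ → ℕ
pairBit i = 3 * 4 ^ i

pairBit-pos : ∀ i → 1 ≤ pairBit i
pairBit-pos i = *-pos {3} (s≤s z≤n) (m^n>0 4 i)

3ab+4abq≡a[b[3+4q]] : ∀ a b q → 3 * (a * b) + 4 * (a * b) * q ≡ a * (b * (3 + 4 * q))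
3ab+4abq≡a[b[3+4q]] = solve-∀

sumOver-pairBit : ∀ {m F} → Increasing F → All (m ≤_) F → ∃ λ q → sumOver pairBit F ≡ 4 ^ m * q × T q ≡ false
sumOver-pairBit {m} {[]}    _          _          = 0 , sym (*-zeroʳ (4 ^ m)) , refl
sumOver-pairBit {m} {i ∷ F} (i<F ∷ incF) (m≤i ∷ _)
  with q , ΣF≡4^[1+i]q , Tq≡false ← sumOver-pairBit incF i<F
     | d , m+d≡i ← m≤n⇒∃[o]m+o≡n m≤i =
  4 ^ d * (3 + 4 * q) , sum≡ , T≡false
  where
  4^i≡4^m·4^d : 4 ^ i ≡ 4 ^ m * 4 ^ d
  4^i≡4^m·4^d = trans (cong (4 ^_) (sym m+d≡i)) (^-distribˡ-+-* 4 m d)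
  sum≡ : pairBit i + sumOver pairBit F ≡ 4 ^ m * (4 ^ d * (3 + 4 * q))
  sum≡ = trans (cong (pairBit i +_) ΣF≡4^[1+i]q)
    (trans (cong (λ P → 3 * P + 4 * P * q) 4^i≡4^m·4^d) (3ab+4abq≡a[b[3+4q]] (4 ^ m) (4 ^ d) q))
  T≡false : T (4 ^ d * (3 + 4 * q)) ≡ false
  T≡false = trans (T-4^* d _) (trans (T-split₄ 1 3 q (s≤s (s≤s (s≤s (s≤s z≤n))))) (cong (false xor_) Tq≡false))

T-sumOver-pairBit : ∀ {F} → Increasing F → T (sumOver pairBit F) ≡ false
T-sumOver-pairBit {F} incF with q , ΣF≡q , Tq≡false ← sumOver-pairBit {0} incF (All.universal (λ _ → z≤n) F) =
  trans (cong T (trans ΣF≡q (*-identityˡ q))) Tq≡false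

OccursAt-T-2^|u|* : ∀ {w : ℕ → Bool} u N → (∀ j → w j ≡ T j xor T N) → IsPrefixOf w u →
                    OccursAt T u (2 ^ length u * N)
OccursAt-T-2^|u|* {w} u N w≡ pre = OccursAt-transport u agree pre
  where
  agree : ∀ j → j < length u → T (2 ^ length u * N + j) ≡ w j
  agree j j<|u| = trans (cong T (+-comm _ j))
    (trans (T-split (length u) j N (<-trans j<|u| (n<2^n (length u)))) (sym (w≡ j)))

prefix-T⇒IPSet : ∀ u → IsPrefixOf T u → IPSet (Occ u)
prefix-T⇒IPSet u pre = x , x-pos , sums
  where
  x : ℕ → ℕ
  x i = 2 ^ length u * pairBit i
  x-pos : ∀ i → 1 ≤ x i
  x-pos i = *-pos (m^n>0 2 (length u)) (pairBit-pos i)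
  sums : ∀ F → IsFinSet F → Occ u (sumOver x F)
  sums F (linkedF , F≢[]) rewrite sumOver-* (2 ^ length u) pairBit F =
    *-pos (m^n>0 2 (length u)) (sumOver-pos pairBit F pairBit-pos F≢[]) ,
    OccursAt-T-2^|u|* u (sumOver pairBit F)
      (λ j → sym (trans (cong (T j xor_) (T-sumOver-pairBit (Linked⇒AllPairs <-trans linkedF))) (xor-identityʳ (T j))))
      pre

-- Prefixes of T̄

allOnes : ℕ → ℕ
allOnes zero    = 0
allOnes (suc m) = suc (2 * allOnes m)

1+allOnes≡2^ : ∀ m → suc (allOnes m) ≡ 2 ^ m
1+allOnes≡2^ zero    = refl
1+allOnes≡2^ (suc m) = trans (sym (2[1+p]≡2+2p (allOnes m))) (cong (2 *_) (1+allOnes≡2^ m))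

n≤allOnes : ∀ n → n ≤ allOnes n
n≤allOnes zero    = z≤n
n≤allOnes (suc n) = s≤s (≤-trans (n≤allOnes n) (m≤m+n _ _))

oddNumber : ℕ → ℕ
oddNumber zero    = 1
oddNumber (suc k) = suc (suc (oddNumber k))

n≤oddNumber : ∀ k → k ≤ oddNumber k
n≤oddNumber zero    = z≤n
n≤oddNumber (suc k) = s≤s (m≤n⇒m≤1+n (n≤oddNumber k))

T-allOnes-oddNumber : ∀ k → T (allOnes (oddNumber k)) ≡ true
T-allOnes-oddNumber zero    = refl
T-allOnes-oddNumber (suc k) = begin
  T (suc (2 * allOnes (suc (oddNumber k)))) ≡⟨ T-double+1 (allOnes (suc (oddNumber k))) ⟩
  not (T (suc (2 * allOnes (oddNumber k)))) ≡⟨ cong not (T-double+1 (allOnes (oddNumber k))) ⟩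
  not (not (T (allOnes (oddNumber k))))     ≡⟨ not-involutive _ ⟩
  T (allOnes (oddNumber k))                 ≡⟨ T-allOnes-oddNumber k ⟩
  true                                      ∎
  where open ≡-Reasoning

-- r + r′ = 2 ^ m - 1 means that the m-bit expansions of r and r′ are complementary.
T-complement : ∀ m r r′ → r + r′ ≡ allOnes m → T r xor T r′ ≡ T (allOnes m)
T-complement zero zero zero refl = refl
T-complement (suc m) r r′ r+r′≡ with parity r | parity r′
... | even a | even b = contradiction (trans (*-distribˡ-+ 2 a b) r+r′≡) (even≢odd (a + b) (allOnes m))
... | odd a  | odd b  =
  contradiction (trans (sym ([1+2p]+[1+2q]≡2[1+p+q] a b)) r+r′≡) (even≢odd (suc (a + b)) (allOnes m))
... | even a | odd b  = begin
  T (2 * a) xor T (suc (2 * b)) ≡⟨ cong₂ _xor_ (T-double a) (T-double+1 b) ⟩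
  T a xor not (T b)             ≡⟨ not-distribʳ-xor (T a) (T b) ⟨
  not (T a xor T b)             ≡⟨ cong not (T-complement m a b (2a+2b≡2c⇒a+b≡c a b (allOnes m) a+b≡)) ⟩
  not (T (allOnes m))           ≡⟨ T-double+1 (allOnes m) ⟨
  T (allOnes (suc m))           ∎
  where open ≡-Reasoning
        a+b≡ : 2 * a + 2 * b ≡ 2 * allOnes m
        a+b≡ = suc-injective (trans (sym (+-suc (2 * a) (2 * b))) r+r′≡)
... | odd a  | even b = begin
  T (suc (2 * a)) xor T (2 * b) ≡⟨ cong₂ _xor_ (T-double+1 a) (T-double b) ⟩
  not (T a) xor T b             ≡⟨ not-distribˡ-xor (T a) (T b) ⟨
  not (T a xor T b)             ≡⟨ cong not (T-complement m a b (2a+2b≡2c⇒a+b≡c a b (allOnes m) a+b≡)) ⟩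
  not (T (allOnes m))           ≡⟨ T-double+1 (allOnes m) ⟨
  T (allOnes (suc m))           ∎
  where open ≡-Reasoning
        a+b≡ : 2 * a + 2 * b ≡ 2 * allOnes m
        a+b≡ = suc-injective r+r′≡

T-[1+s]*allOnes : ∀ m s → s ≤ allOnes m → T (suc s * allOnes m) ≡ T (allOnes m)
T-[1+s]*allOnes m s s≤O = begin
  T (suc s * O)                    ≡⟨ cong T split ⟩
  T ((O ∸ s) + 2 ^ m * s)          ≡⟨ T-split m (O ∸ s) s O∸s<2^m ⟩
  T (O ∸ s) xor T s                ≡⟨ T-complement m (O ∸ s) s (m∸n+n≡m s≤O) ⟩
  T O                              ∎
  where
  open ≡-Reasoning
  O : ℕ
  O = allOnes m
  O∸s<2^m : O ∸ s < 2 ^ m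
  O∸s<2^m = subst (O ∸ s <_) (1+allOnes≡2^ m) (s≤s (m∸n≤m O s))
  split : suc s * O ≡ (O ∸ s) + 2 ^ m * s
  split = begin
    O + s * O             ≡⟨ cong (_+ s * O) (m∸n+n≡m s≤O) ⟨
    (O ∸ s) + s + s * O   ≡⟨ +-assoc (O ∸ s) s (s * O) ⟩
    (O ∸ s) + (s + s * O) ≡⟨ cong (λ z → (O ∸ s) + (s + z)) (*-comm s O) ⟩
    (O ∸ s) + suc O * s   ≡⟨ cong (λ z → (O ∸ s) + z * s) (1+allOnes≡2^ m) ⟩
    (O ∸ s) + 2 ^ m * s   ∎

s*allOnes<4^ : ∀ m s → s ≤ allOnes m → s * allOnes m < 4 ^ m
s*allOnes<4^ m s s≤O = begin-strict
  s * O         ≤⟨ *-monoˡ-≤ O s≤O ⟩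
  O * O         <⟨ *-mono-< O<2^m O<2^m ⟩
  2 ^ m * 2 ^ m ≡⟨ ^-distribˡ-+-* 2 m m ⟨
  2 ^ (m + m)   ≡⟨ cong (λ n → 2 ^ (m + n)) (+-identityʳ m) ⟨
  2 ^ (2 * m)   ≡⟨ 4^m≡2^[2m] m ⟨
  4 ^ m         ∎
  where
  open ≤-Reasoning
  O : ℕ
  O = allOnes m
  O<2^m : O < 2 ^ m
  O<2^m = subst (O <_) (1+allOnes≡2^ m) ≤-refl

T-[s*allOnes+4^m*Y] : ∀ k s Y → 1 ≤ s → s ≤ k → T Y ≡ false →
                      T (s * allOnes (oddNumber k) + 4 ^ oddNumber k * Y) ≡ true
T-[s*allOnes+4^m*Y] k (suc s′) Y _ s≤k TY≡false = begin
  T (suc s′ * O + 4 ^ m * Y) ≡⟨ T-split₄ m (suc s′ * O) Y (s*allOnes<4^ m (suc s′) 1+s′≤O) ⟩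
  T (suc s′ * O) xor T Y     ≡⟨ cong₂ _xor_ (T-[1+s]*allOnes m s′ (<⇒≤ 1+s′≤O)) TY≡false ⟩
  T O xor false              ≡⟨ xor-identityʳ (T O) ⟩
  T O                        ≡⟨ T-allOnes-oddNumber k ⟩
  true                       ∎
  where
  open ≡-Reasoning
  m O : ℕ
  m = oddNumber k
  O = allOnes m
  1+s′≤O : suc s′ ≤ O
  1+s′≤O = ≤-trans s≤k (≤-trans (n≤oddNumber k) (n≤allOnes m))

2[c+D*pairBit[n]]≤c+D*pairBit[1+n] : ∀ c D n → c ≤ D → 2 * (c + D * pairBit n) ≤ c + D * pairBit (suc n)
2[c+D*pairBit[n]]≤c+D*pairBit[1+n] c D n c≤D = begin
  2 * (c + D * pairBit n)           ≡⟨ expand c D (4 ^ n) ⟩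
  c + (c + 6 * (D * 4 ^ n))         ≤⟨ +-monoʳ-≤ c (+-monoˡ-≤ (6 * (D * 4 ^ n)) c≤D*4^n) ⟩
  c + (D * 4 ^ n + 6 * (D * 4 ^ n)) ≤⟨ +-monoʳ-≤ c (*-monoˡ-≤ (D * 4 ^ n) {7} {12} (+-monoʳ-≤ 7 z≤n)) ⟩
  c + 12 * (D * 4 ^ n)              ≡⟨ cong (c +_) (collect D (4 ^ n)) ⟩
  c + D * pairBit (suc n)           ∎
  where
  open ≤-Reasoning
  c≤D*4^n : c ≤ D * 4 ^ n
  c≤D*4^n = ≤-trans c≤D (≤-trans (≤-reflexive (sym (*-identityʳ D))) (*-monoʳ-≤ D (m^n>0 4 n)))
  expand : ∀ c D E → 2 * (c + D * (3 * E)) ≡ c + (c + 6 * (D * E))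
  expand = solve-∀
  collect : ∀ D E → 12 * (D * E) ≡ D * (3 * (4 * E))
  collect = solve-∀

prefix-Tbar⇒InfFSBig : ∀ u → IsPrefixOf Tbar u → InfFSBig (Occ u)
prefix-Tbar⇒InfFSBig u pre k k≥1 = x , x-pos , superincreasing⇒UFS (doubling⇒superincreasing (x-pos 0) x-doubling) , sums
  where
  K m c D : ℕ
  K = length u
  m = oddNumber k
  c = allOnes m
  D = 4 ^ m
  y : ℕ → ℕ
  y i = c + D * pairBit i
  x : ℕ → ℕ
  x i = 2 ^ K * y i
  c≤D : c ≤ D
  c≤D = ≤-trans (n≤1+n c) (subst (_≤ D) (sym (1+allOnes≡2^ m)) (^-monoˡ-≤ m (s≤s (s≤s z≤n))))
  c≥1 : 1 ≤ c
  c≥1 = ≤-trans k≥1 (≤-trans (n≤oddNumber k) (n≤allOnes m))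
  x-pos : ∀ i → 1 ≤ x i
  x-pos i = *-pos (m^n>0 2 K) (≤-trans c≥1 (m≤m+n c _))
  x-doubling : ∀ n → 2 * x n ≤ x (suc n)
  x-doubling n = begin
    2 * (2 ^ K * y n) ≡⟨ x∙yz≈y∙xz 2 (2 ^ K) (y n) ⟩
    2 ^ K * (2 * y n) ≤⟨ *-monoʳ-≤ (2 ^ K) (2[c+D*pairBit[n]]≤c+D*pairBit[1+n] c D n c≤D) ⟩
    2 ^ K * y (suc n) ∎
    where open ≤-Reasoning
  sums : ∀ F → IsFinSet F → length F ≤ k → Occ u (sumOver x F)
  sums F (linkedF , F≢[]) |F|≤k rewrite sumOver-* (2 ^ K) y F | sumOver-affine c D pairBit F =
    *-pos (m^n>0 2 K) (≤-trans c≥1 (≤-trans c≤|F|c (m≤m+n _ _))) ,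
    OccursAt-T-2^|u|* u (length F * c + D * sumOver pairBit F)
      (λ j → sym (trans (cong (T j xor_) (T-[s*allOnes+4^m*Y] k (length F) (sumOver pairBit F) |F|≥1 |F|≤k
                                           (T-sumOver-pairBit (Linked⇒AllPairs <-trans linkedF))))
                        (xor-comm (T j) true)))
      pre
    where
    |F|≥1 : 1 ≤ length F
    |F|≥1 = length-pos F≢[]
    c≤|F|c : c ≤ length F * c
    c≤|F|c = ≤-trans (≤-reflexive (sym (*-identityˡ c))) (*-monoˡ-≤ c |F|≥1)

HasEvenSum : ℕ → ℕ → Set
HasEvenSum a b = ∃ λ r → a + b ≡ 2 * r

two-of-three-evenSum : ∀ a b c → HasEvenSum a b ⊎ HasEvenSum a c ⊎ HasEvenSum b c
two-of-three-evenSum a b c with parity a | parity b | parity c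
... | even p | even q | _      = inj₁ (p + q , 2p+2q≡2[p+q] p q)
... | odd p  | odd q  | _      = inj₁ (suc (p + q) , [1+2p]+[1+2q]≡2[1+p+q] p q)
... | even p | odd _  | even r = inj₂ (inj₁ (p + r , 2p+2q≡2[p+q] p r))
... | odd p  | even _ | odd r  = inj₂ (inj₁ (suc (p + r) , [1+2p]+[1+2q]≡2[1+p+q] p r))
... | even _ | odd q  | odd r  = inj₂ (inj₂ (suc (q + r) , [1+2p]+[1+2q]≡2[1+p+q] q r))
... | odd _  | even q | even r = inj₂ (inj₂ (q + r , 2p+2q≡2[p+q] q r))

record DivisibleBlock (x : ℕ → ℕ) (M s : ℕ) : Set where
  field
    indices    : List ℕ
    increasing : Increasing indices
    nonempty   : indices ≢ []
    above      : All (s ≤_) indices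
    quotient   : ℕ
    sum≡       : sumOver x indices ≡ 2 ^ M * quotient

module _ {x : ℕ → ℕ} where
  open DivisibleBlock

  weaken : ∀ {M s t} → s ≤ t → DivisibleBlock x M t → DivisibleBlock x M s
  weaken s≤t B = record
    { indices = indices B ; increasing = increasing B ; nonempty = nonempty B
    ; above = All.map (≤-trans s≤t) (above B) ; quotient = quotient B ; sum≡ = sum≡ B }

  concatBlocks : ∀ {M s t} (B : DivisibleBlock x M s) (B′ : DivisibleBlock x M t) → s ≤ t → All (_< t) (indices B) →
                 HasEvenSum (quotient B) (quotient B′) → DivisibleBlock x (suc M) s
  concatBlocks {M} B B′ s≤t B<t (r , q+q′≡2r) = record
    { indices    = indices B ++ indices B′
    ; increasing = Increasing-++ (increasing B) (increasing B′) B<t (above B′)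
    ; nonempty   = λ B++B′≡[] → nonempty B (++-conicalˡ (indices B) (indices B′) B++B′≡[])
    ; above      = Allₚ.++⁺ (above B) (All.map (≤-trans s≤t) (above B′))
    ; quotient   = r
    ; sum≡       = begin
        sumOver x (indices B ++ indices B′)           ≡⟨ sumOver-++ x (indices B) (indices B′) ⟩
        sumOver x (indices B) + sumOver x (indices B′) ≡⟨ cong₂ _+_ (sum≡ B) (sum≡ B′) ⟩
        2 ^ M * quotient B + 2 ^ M * quotient B′       ≡⟨ *-distribˡ-+ (2 ^ M) _ _ ⟨
        2 ^ M * (quotient B + quotient B′)             ≡⟨ cong (2 ^ M *_) q+q′≡2r ⟩
        2 ^ M * (2 * r)                                ≡⟨ x∙yz≈y∙xz (2 ^ M) 2 r ⟩
        2 * (2 ^ M * r)                                ≡⟨ *-assoc 2 (2 ^ M) r ⟨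
        2 ^ suc M * r                                  ∎
    }
    where open ≡-Reasoning

  concatTwoOfThree : ∀ {M s t₂ t₃}
                     (B₁ : DivisibleBlock x M s) (B₂ : DivisibleBlock x M t₂) (B₃ : DivisibleBlock x M t₃) →
                     s ≤ t₂ → t₂ ≤ t₃ → All (_< t₂) (indices B₁) → All (_< t₃) (indices B₂) →
                     DivisibleBlock x (suc M) s
  concatTwoOfThree B₁ B₂ B₃ s≤t₂ t₂≤t₃ B₁<t₂ B₂<t₃
    with two-of-three-evenSum (quotient B₁) (quotient B₂) (quotient B₃)
  ... | inj₁ even₁₂        = concatBlocks B₁ B₂ s≤t₂ B₁<t₂ even₁₂
  ... | inj₂ (inj₁ even₁₃) =
    concatBlocks B₁ B₃ (≤-trans s≤t₂ t₂≤t₃) (All.map (λ i<t₂ → <-≤-trans i<t₂ t₂≤t₃) B₁<t₂) even₁₃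
  ... | inj₂ (inj₂ even₂₃) = weaken s≤t₂ (concatBlocks B₂ B₃ t₂≤t₃ B₂<t₃ even₂₃)

divisibleBlock : ∀ x M s → DivisibleBlock x M s
divisibleBlock x zero    s = record
  { indices = s ∷ [] ; increasing = [] ∷ [] ; nonempty = λ () ; above = ≤-refl ∷ []
  ; quotient = x s ; sum≡ = trans (+-identityʳ (x s)) (sym (*-identityˡ (x s))) }
divisibleBlock x (suc M) s =
  concatTwoOfThree B₁ B₂ B₃ (m≤m+n s _) (+-monoʳ-≤ s (s≤s (m≤m+n _ _)))
    (All.map (λ i≤Σ → ≤-trans (s≤s i≤Σ) (m≤n+m _ s)) (All-≤-sum (indices B₁)))
    (All.map (λ i≤Σ → ≤-trans (s≤s (≤-trans i≤Σ (m≤n+m _ _))) (m≤n+m _ s)) (All-≤-sum (indices B₂)))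
  where
  open DivisibleBlock
  B₁ : DivisibleBlock x M s
  B₁ = divisibleBlock x M s
  t₂ : ℕ
  t₂ = s + suc (sum (indices B₁))
  B₂ : DivisibleBlock x M t₂
  B₂ = divisibleBlock x M t₂
  t₃ : ℕ
  t₃ = s + suc (sum (indices B₁) + sum (indices B₂))
  B₃ : DivisibleBlock x M t₃
  B₃ = divisibleBlock x M t₃

prefix-Tbar⇒¬IPSet : ∀ u → u ≢ [] → IsPrefixOf Tbar u → ¬ IPSet (Occ u)
prefix-Tbar⇒¬IPSet []      u≢[] _           _                 = contradiction refl u≢[]
prefix-Tbar⇒¬IPSet (b ∷ u) _    (true≡b , _) (x , _ , sums) = contradiction (trans (sym T-sum-G) (T-sum G G-finSet)) λ ()
  where
  open DivisibleBlock (divisibleBlock x (x 0) 1)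
  M : ℕ
  M = x 0
  T-sum : ∀ F → IsFinSet F → T (sumOver x F) ≡ true
  T-sum F finF = trans (proj₁ (proj₂ (sums F finF))) (sym true≡b)
  G : List ℕ
  G = 0 ∷ indices
  G-finSet : IsFinSet G
  G-finSet = AllPairs⇒Linked (above ∷ increasing) , λ ()
  T-quotient : T quotient ≡ true
  T-quotient = begin
    T quotient              ≡⟨ T-split M 0 quotient (m^n>0 2 M) ⟨
    T (2 ^ M * quotient)    ≡⟨ cong T sum≡ ⟨
    T (sumOver x indices)   ≡⟨ T-sum indices (AllPairs⇒Linked increasing , nonempty) ⟩
    true                    ∎
    where open ≡-Reasoning
  T-sum-G : T (sumOver x G) ≡ false
  T-sum-G = begin
    T (x 0 + sumOver x indices)     ≡⟨ cong (λ n → T (x 0 + n)) sum≡ ⟩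
    T (x 0 + 2 ^ M * quotient)      ≡⟨ T-split M (x 0) quotient (n<2^n M) ⟩
    T (x 0) xor T quotient          ≡⟨ cong₂ _xor_ T-x₀ T-quotient ⟩
    false                           ∎
    where open ≡-Reasoning
          T-x₀ : T (x 0) ≡ true
          T-x₀ = trans (cong T (sym (+-identityʳ (x 0)))) (T-sum (0 ∷ []) ([-] , λ ()))

-- Other factors

module LongFactor (a b c d : Bool) (r : Word) where

  u : Word
  u = a ∷ b ∷ c ∷ d ∷ r

  -- At an even position the letters come in pairs b (not b); at an odd position this forces a cube.
  ¬even∧odd : ∀ p q → OccursAt T u (2 * p) → ¬ OccursAt T u (suc (2 * q))
  ¬even∧odd p q (≡a , ≡b , ≡c , ≡d , _) (≡a′ , ≡b′ , ≡c′ , ≡d′ , _) =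
    T-cube-free q Tq≡T[1+q] T[1+q]≡T[2+q]
    where
    b≡not-a : b ≡ not a
    b≡not-a = trans (sym ≡b) (trans (T-double+1 p) (cong not (trans (sym (T-double p)) ≡a)))
    d≡not-c : d ≡ not c
    d≡not-c = trans (sym ≡d) (trans (T-double+3 p) (cong not (trans (sym (T-double+2 p)) ≡c)))
    Tq≡T[1+q] : T q ≡ T (suc q)
    Tq≡T[1+q] = trans (sym (not-involutive (T q)))
      (trans (cong not (trans (sym (T-double+1 q)) ≡a′)) (sym (trans (sym (T-double+2 q)) (trans ≡b′ b≡not-a))))
    T[1+q]≡T[2+q] : T (suc q) ≡ T (suc (suc q))
    T[1+q]≡T[2+q] = trans (sym (not-involutive (T (suc q))))
      (trans (cong not (trans (sym (T-double+3 q)) ≡c′)) (sym (trans (sym (T-double+4 q)) (trans ≡d′ d≡not-c))))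

  even-occurrence⇒even : ∀ {n n′} → OccursAt T u n → OccursAt T u n′ → Even n → Even n′
  even-occurrence⇒even {n′ = n′} occ occ′ (p , refl) with even⊎odd n′
  ... | inj₁ n′-even       = n′-even
  ... | inj₂ (q , refl) = contradiction occ′ (¬even∧odd p q occ)

  odd-occurrence⇒odd : ∀ {n n′} → OccursAt T u n → OccursAt T u n′ → Odd n → Odd n′
  odd-occurrence⇒odd {n′ = n′} occ occ′ (p , refl) with even⊎odd n′
  ... | inj₁ (q , refl) = contradiction occ (¬even∧odd q p occ′)
  ... | inj₂ n′-odd     = n′-odd

  summable⇒occurrences-even : ∀ {k} → 2 ≤ k → Summable (Occ u) k → ∀ {n} → Occ u n → Even n
  summable⇒occurrences-even {k} 2≤k S {n} (_ , occ) = by-parity (even⊎odd (x 0))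
    where
    open Summands {Occ u} S
    occ₀ : OccursAt T u (x 0)
    occ₀ = proj₂ (summand₁ (<-trans 0<1 2≤k))
    by-parity : Even (x 0) ⊎ Odd (x 0) → Even n
    by-parity (inj₁ x₀-even) = even-occurrence⇒even occ₀ occ x₀-even
    by-parity (inj₂ x₀-odd)  =
      contradiction S (odd⇒¬2-summable {Occ u} 2≤k (λ (_ , occ′) → odd-occurrence⇒odd occ₀ occ′ x₀-odd))

  even-occurrence : ∀ {k} → 2 ≤ k → Summable (Occ u) k → ∃ λ p → OccursAt T u (2 * p)
  even-occurrence 2≤k S = proj₁ x₀-even , subst (OccursAt T u) (proj₂ x₀-even) (proj₂ occ₀)
    where
    open Summands {Occ u} S
    occ₀ : Occ u (x 0)
    occ₀ = summand₁ (<-trans 0<1 2≤k)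
    x₀-even : Even (x 0)
    x₀-even = summable⇒occurrences-even 2≤k S occ₀

  decode-summable : ∀ {k} → 2 ≤ k → Summable (Occ u) k → Summable (Occ (decode u)) k
  decode-summable 2≤k S = Summable-halve (summable⇒occurrences-even 2≤k S) halve S
    where
    halve : ∀ p → Occ u (2 * p) → Occ (decode u) p
    halve (suc p) (_ , occ) = s≤s z≤n , OccursAt-decode u (suc p) occ

  decode-shorter : length (decode u) < length u
  decode-shorter = s≤s (s≤s (s≤s (m≤n⇒m≤1+n (decode-length r))))

alternating₃-Residue₂₃ : ∀ a n → OccursAt T (a ∷ not a ∷ a ∷ []) n → Residue₂₃ n
alternating₃-Residue₂₃ a n (≡a , ≡not-a , ≡a′ , _) with parity n
... | even p with T-equal-neighbours⇒odd p (trans (trans (sym (T-double p)) ≡a) (sym (trans (sym (T-double+2 p)) ≡a′)))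
...   | q , refl = inj₁ (trans (cong (_% 4) (4q+2 q)) ([m+kn]%n≡m%n 2 q 4))
  where 4q+2 : ∀ q → 2 * suc (2 * q) ≡ 2 + q * 4
        4q+2 = solve-∀
alternating₃-Residue₂₃ a n (≡a , ≡not-a , ≡a′ , _) | odd p
  with T-equal-neighbours⇒odd p (trans (sym (not-involutive (T p)))
         (trans (cong not (trans (sym (T-double+1 p)) ≡a)) (sym (trans (sym (T-double+2 p)) ≡not-a))))
...   | q , refl = inj₂ (trans (cong (_% 4) (4q+3 q)) ([m+kn]%n≡m%n 3 q 4))
  where 4q+3 : ∀ q → suc (2 * suc (2 * q)) ≡ 3 + q * 4
        4q+3 = solve-∀

alternating₃-¬3-summable : ∀ a → ¬ Summable (Occ (a ∷ not a ∷ a ∷ [])) 3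
alternating₃-¬3-summable a =
  Residue₂₃⇒¬3-summable {Occ (a ∷ not a ∷ a ∷ [])} (λ {n} (_ , occ) → alternating₃-Residue₂₃ a n occ)

square-occurrences-odd : ∀ b r {n} → Occ (b ∷ b ∷ r) n → Odd n
square-occurrences-odd b r {n} (_ , ≡b , ≡b′ , _) = T-equal-neighbours⇒odd n (trans ≡b (sym ≡b′))

data Reduction (k : ℕ) : Word → Set where
  alternating₃ : ∀ a → Reduction k (a ∷ not a ∷ a ∷ [])
  descends     : ∀ {u} → Summable (Occ (decode u)) k → ¬ IsPrefixOf T (decode u) → ¬ IsPrefixOf Tbar (decode u) →
                 IsListPrefix u (τ (decode u)) → length (decode u) < length u → Reduction k u

reduce : ∀ {k} u → 2 ≤ k → Summable (Occ u) k → ¬ IsPrefixOf T u → ¬ IsPrefixOf Tbar u → Reduction k u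
reduce []                          _   _ ¬T _    = contradiction tt ¬T
reduce (false ∷ [])                _   _ ¬T _    = contradiction (refl , tt) ¬T
reduce (true ∷ [])                 _   _ _  ¬T̄   = contradiction (refl , tt) ¬T̄
reduce (false ∷ false ∷ r)         2≤k S _  _    =
  contradiction S (odd⇒¬2-summable {Occ (false ∷ false ∷ r)} 2≤k (square-occurrences-odd false r))
reduce (true ∷ true ∷ r)           2≤k S _  _    =
  contradiction S (odd⇒¬2-summable {Occ (true ∷ true ∷ r)} 2≤k (square-occurrences-odd true r))
reduce (false ∷ true ∷ [])         _   _ ¬T _    = contradiction (refl , refl , tt) ¬T
reduce (true ∷ false ∷ [])         _   _ _  ¬T̄   = contradiction (refl , refl , tt) ¬T̄
reduce (false ∷ true ∷ false ∷ []) _   _ _  _    = alternating₃ false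
reduce (true ∷ false ∷ true ∷ [])  _   _ _  _    = alternating₃ true
reduce (false ∷ true ∷ true ∷ [])  _   _ ¬T _    = contradiction (refl , refl , refl , tt) ¬T
reduce (true ∷ false ∷ false ∷ []) _   _ _  ¬T̄   = contradiction (refl , refl , refl , tt) ¬T̄
reduce (a ∷ b ∷ c ∷ d ∷ r)         2≤k S ¬T ¬T̄ =
  descends (decode-summable 2≤k S)
    (¬T ∘ IsPrefixOf-T-decode⇒IsPrefixOf-T u p occ) (¬T̄ ∘ IsPrefixOf-Tbar-decode⇒IsPrefixOf-Tbar u p occ)
    (IsListPrefix-τ-decode u p occ) decode-shorter
  where
  open LongFactor a b c d r
  p : ℕ
  p = proj₁ (even-occurrence 2≤k S)
  occ : OccursAt T u (2 * p)
  occ = proj₂ (even-occurrence 2≤k S)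

¬prefix⇒¬3-summable : ∀ {f} u → length u < f → ¬ IsPrefixOf T u → ¬ IsPrefixOf Tbar u → ¬ Summable (Occ u) 3
¬prefix⇒¬3-summable {suc f} u (s≤s |u|≤f) ¬T ¬T̄ S with reduce u (s≤s (s≤s z≤n)) S ¬T ¬T̄
... | alternating₃ a = alternating₃-¬3-summable a S
... | descends S′ ¬T′ ¬T̄′ _ shorter =
  ¬prefix⇒¬3-summable (decode u) (<-≤-trans shorter |u|≤f) ¬T′ ¬T̄′ S′

PrefixOfIteratedAlternating₃ : Word → Set
PrefixOfIteratedAlternating₃ u =
  ∃ λ n → IsListPrefix u (τ^ n (false ∷ true ∷ false ∷ []))
        ⊎ IsListPrefix u (τ^ n (true ∷ false ∷ true ∷ []))

PrefixOfIterated-τ : ∀ {u v} → IsListPrefix u (τ v) →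
                     PrefixOfIteratedAlternating₃ v → PrefixOfIteratedAlternating₃ u
PrefixOfIterated-τ u≤τv (n , inj₁ v≤τⁿ010) = suc n , inj₁ (IsListPrefix-trans u≤τv (IsListPrefix-τ v≤τⁿ010))
PrefixOfIterated-τ u≤τv (n , inj₂ v≤τⁿ101) = suc n , inj₂ (IsListPrefix-trans u≤τv (IsListPrefix-τ v≤τⁿ101))

¬prefix∧2-summable⇒PrefixOfIterated : ∀ {f} u → length u < f → ¬ IsPrefixOf T u → ¬ IsPrefixOf Tbar u →
                                     Summable (Occ u) 2 → PrefixOfIteratedAlternating₃ u
¬prefix∧2-summable⇒PrefixOfIterated {suc f} u (s≤s |u|≤f) ¬T ¬T̄ S with reduce u ≤-refl S ¬T ¬T̄
... | alternating₃ false = 0 , inj₁ ([] , refl)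
... | alternating₃ true  = 0 , inj₂ ([] , refl)
... | descends S′ ¬T′ ¬T̄′ u≤τdu shorter =
  PrefixOfIterated-τ u≤τdu
    (¬prefix∧2-summable⇒PrefixOfIterated (decode u) (<-≤-trans shorter |u|≤f) ¬T′ ¬T̄′ S′)

prefix-τ^⇒2-summable : ∀ w a b → OccursAt T w a → OccursAt T w b → OccursAt T w (a + b) → 1 ≤ a → 2 * a ≤ b →
                        ∀ n {u} → IsListPrefix u (τ^ n w) → Summable (Occ u) 2
prefix-τ^⇒2-summable w a b occ-a occ-b occ-a+b a≥1 2a≤b n {u} u≤τⁿw =
  2-summable {Occ u} (*-pos 2ⁿ≥1 a≥1) 2·2ⁿa≤2ⁿb (occ a≥1 occ-a) (occ b≥1 occ-b)
    (subst (Occ u) (*-distribˡ-+ (2 ^ n) a b) (occ (≤-trans a≥1 (m≤m+n a b)) occ-a+b))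
  where
  2ⁿ≥1 : 1 ≤ 2 ^ n
  2ⁿ≥1 = m^n>0 2 n
  b≥1 : 1 ≤ b
  b≥1 = ≤-trans a≥1 (≤-trans (m≤m+n a (a + 0)) 2a≤b)
  2·2ⁿa≤2ⁿb : 2 * (2 ^ n * a) ≤ 2 ^ n * b
  2·2ⁿa≤2ⁿb = ≤-trans (≤-reflexive (x∙yz≈y∙xz 2 (2 ^ n) a)) (*-monoʳ-≤ (2 ^ n) 2a≤b)
  occ : ∀ {m} → 1 ≤ m → OccursAt T w m → Occ u (2 ^ n * m)
  occ {m} m≥1 occ-m = *-pos 2ⁿ≥1 m≥1 , OccursAt-prefix u≤τⁿw (OccursAt-T-τ^ n w m occ-m)

PrefixOfIterated⇒2-summable : ∀ u → PrefixOfIteratedAlternating₃ u → Summable (Occ u) 2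
PrefixOfIterated⇒2-summable u (n , inj₁ u≤τⁿ010) =
  prefix-τ^⇒2-summable (false ∷ true ∷ false ∷ []) 3 15
    (refl , refl , refl , tt) (refl , refl , refl , tt) (refl , refl , refl , tt) (s≤s z≤n) (+-monoʳ-≤ 6 z≤n) n u≤τⁿ010
PrefixOfIterated⇒2-summable u (n , inj₂ u≤τⁿ101) =
  prefix-τ^⇒2-summable (true ∷ false ∷ true ∷ []) 19 79
    (refl , refl , refl , tt) (refl , refl , refl , tt) (refl , refl , refl , tt) (s≤s z≤n) (+-monoʳ-≤ 38 z≤n) n u≤τⁿ101

theorem7 : ∀ (u : Word) → u ≢ [] → IsFactor T u →
    (IsPrefixOf T u → IPSet (Occ u)) ×
    (IsPrefixOf Tbar u → InfFSBig (Occ u) × ¬ IPSet (Occ u)) ×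
    (¬ IsPrefixOf T u → ¬ IsPrefixOf Tbar u →
      ¬ Summable (Occ u) 3 ×
      (Summable (Occ u) 2 ⇔
        (∃ λ (n : ℕ) → IsListPrefix u (τ^ n (false ∷ true ∷ false ∷ []))
                     ⊎ IsListPrefix u (τ^ n (true ∷ false ∷ true ∷ [])))))
theorem7 u u≢[] _ =
  prefix-T⇒IPSet u ,
  (λ pre → prefix-Tbar⇒InfFSBig u pre , prefix-Tbar⇒¬IPSet u u≢[] pre) ,
  (λ ¬T ¬T̄ → ¬prefix⇒¬3-summable u ≤-refl ¬T ¬T̄ ,
             mk⇔ (¬prefix∧2-summable⇒PrefixOfIterated u ≤-refl ¬T ¬T̄) (PrefixOfIterated⇒2-summable u))
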